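{- Let $(a_n)$ be a sequence of integers that satisfies the Kummer congruences (defined in the context). Then for all positive integers $b,n,\alpha$ and every prime $p$ with $p\nmid n$, $$a_{b+np^\alpha}\equiv a_{b+np^{\alpha-1}}\pmod{p^\alpha}.$$ Consequently, for every positive integer $b$, the sequence $(a_{b+n})_{n=1}^\infty$ is pre-realizable.
   Context: A sequence $(a_n)$ of integers satisfies the Kummer congruences if for every prime $p$ and all integers $e\ge1$, $n\ge1$, $m\ge0$ and $w$ with $p^{e-1}(p-1)\mid w$ (whenever the indices involved lie in the index range of the sequence) we have $$\sum_{s=0}^n(-1)^s\binom{n}{s}a_{m+sw}\equiv 0\pmod{p^{\min(m,\,ne)}},$$ i.e. modulo the ideal $(p^m,p^{ne})$. A sequence of integers $(c_n)_{n\ge1}$ is pre-realizable if for every $n\ge1$ the integer $\sum_{d\mid n}\mu(n/d)c_d$ is divisible by $n$, where $\mu$ is the Möbius function ($\mu(n)=(-1)^k$ if $n$ is a product of $k$ distinct primes, $\mu(n)=0$ if $n$ is not squarefree). -}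

module Defs where

open import Data.Nat as ℕ using (ℕ; zero; suc; _+_; _*_; _∸_; _^_; _⊓_; _≥_)
open import Data.Nat.Divisibility as ℕD using (_∣?_)
open import Data.Nat.DivMod using (_/_)
open import Data.Nat.Primality using (Prime; prime?)
open import Data.Nat.Combinatorics using (_C_)
open import Data.List using (List; []; _∷_; upTo; filter; length; map; foldr; drop)
open import Data.Integer as ℤ using (ℤ; +_; -_)
open import Data.Integer.Divisibility as ℤD using ()
open import Relation.Nullary using (¬_; does)
open import Relation.Nullary.Decidable using (¬?)
open import Data.Bool using (if_then_else_)

sumℤ : List ℤ → ℤ
sumℤ = foldr ℤ._+_ (+ 0)

sgn : ℕ → ℤ
sgn zero = + 1
sgn (suc s) = - sgn s

kummerSum : (ℕ → ℤ) → (n m w : ℕ) → ℤ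
kummerSum a n m w =
  sumℤ (map (λ s → sgn s ℤ.* ((+ (n C s)) ℤ.* a (m + s * w))) (upTo (suc n)))

KummerCongruences : (ℕ → ℤ) → Set
KummerCongruences a =
  ∀ (p : ℕ) → Prime p →
  ∀ (e n m w : ℕ) → e ≥ 1 → n ≥ 1 →
  (p ^ (e ∸ 1) * (p ∸ 1)) ℕD.∣ w →
  (+ (p ^ (m ⊓ (n * e)))) ℤD.∣ kummerSum a n m w

-- Möbius function, as defined in the paper: μ(n) = (-1)^k if n is a product of
-- k distinct primes, 0 if n is not squarefree (n ≥ 1; value at 0 irrelevant).
-- squarefree: no d ≥ 2 with d*d ∣ n (checking d ≤ n suffices)
allᵇ : (ℕ → Data.Bool.Bool) → List ℕ → Data.Bool.Bool
allᵇ f = foldr (λ x r → f x Data.Bool.∧ r) Data.Bool.true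

squarefreeᵇ : ℕ → Data.Bool.Bool
squarefreeᵇ n = allᵇ (λ d → Data.Bool.not (does ((d * d) ∣? n))) (drop 2 (upTo (suc n)))

numPrimeDivisors : ℕ → ℕ
numPrimeDivisors n = length (filter (λ p → prime? p) (filter (λ d → d ∣? n) (drop 1 (upTo (suc n)))))

μ : ℕ → ℤ
μ n = if squarefreeᵇ n then sgn (numPrimeDivisors n) else + 0

-- Σ_{d ∣ n} μ(n/d) c_d   (for n ≥ 1; d ranges over 1..n, written d = suc k)
mobiusSum : (ℕ → ℤ) → ℕ → ℤ
mobiusSum c n =
  sumℤ (map (λ k → if does (suc k ∣? n) then μ (n / suc k) ℤ.* c (suc k) else + 0) (upTo n))

-- pre-realizable sequence (c_n)_{n ≥ 1}  (value c 0 is never used)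
PreRealizable : (ℕ → ℤ) → Set
PreRealizable c = ∀ (n : ℕ) → n ≥ 1 → (+ n) ℤD.∣ mobiusSum c n

-- Write c x = a (b + x). The Kummer congruence with n = 1, e = α + 1, m = b + x and
-- w = x (p − 1) says c (x p) ≡ c x (mod p^(α+1)) whenever p^α ∣ x, since then
-- b + x ≥ p^α > α; the first claim is the case x = n p^(α−1).
--
-- These congruences give pre-realizability one prime power at a time. Let p^α ∣ n, α ≥ 1.
-- In Σ_{d ∣ n} μ(n/d) c d only the d with p² ∤ n/d contribute, and d ↦ d p matches those
-- with p ∣ n/d to those with p ∤ n/d (which are multiples of p, as p ∣ n). Since
-- μ(n/d) = −μ(n/(d p)), a matched pair contributes μ(n/(d p)) (c (d p) − c d) with
-- p^(α−1) ∣ d, hence a multiple of p^α. Finally, n divides every number that all prime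
-- powers dividing n divide.

{-# OPTIONS --safe #-}
module Submission where

open import Defs
open import Data.Nat using (ℕ; _+_; _*_; _∸_; _^_; _≥_)
open import Data.Nat.Divisibility using (_∣_)
open import Data.Nat.Primality using (Prime)
open import Data.Integer as ℤ using (ℤ; +_)
open import Data.Integer.Divisibility as ℤD using ()
open import Data.Product using (_×_)
open import Relation.Nullary using (¬_)

open import Data.Bool using (Bool; true; false; T; _∧_; not; if_then_else_)
open import Data.Bool.Properties using (T-∧; ∧-zeroʳ)
open import Data.Integer using (0ℤ)
open import Data.Integer.Divisibility.Signed as ℤ∣ using () renaming (_∣_ to _∣ℤ_)
import Data.Integer.Properties as ℤP
open import Algebra.Properties.CommutativeSemigroup ℤP.+-commutativeSemigroup using (interchange)
import Data.Integer.Tactic.RingSolver as ℤ-Solver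
open import Data.List using ([]; _∷_; applyUpTo; filter; length)
open import Data.List.Properties using (map-upTo)
open import Data.List.Relation.Unary.All using (All; []; _∷_)
open import Data.List.Relation.Unary.All.Properties using (applyUpTo⁺₁; applyUpTo⁻)
open import Data.Nat
  using (zero; suc; 2+; _≤_; _<_; _⊓_; z≤n; s≤s; z<s; s<s; NonZero; NonTrivial;
         ≢-nonZero; ≢-nonZero⁻¹; >-nonZero; nonTrivial⇒n>1)
open import Data.Nat.Coprimality using (Coprime; coprime-divisor)
import Data.Nat.Coprimality as Coprime
open import Data.Nat.DivMod using (_/_)
open import Data.Nat.Divisibility
  using (divides; quotient; _∣?_; _∣0; 1∣_; ∣-refl; ∣-trans; ∣⇒≤; 0∣⇒≡0; ∣m⇒∣m*n; n∣m*n; m∣m*n;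
         ∣m+n∣m⇒∣n; *-monoˡ-∣; *-cancelˡ-∣; *-cancelʳ-∣; quotient≢0; quotient-<; n/m≡quotient;
         m∣n⇒n≡quotient*m)
open import Data.Nat.Induction using (<-wellFounded)
open import Data.Nat.ListAction using (product)
open import Data.Nat.Primality
  using (prime?; prime⇒irreducible; prime⇒nonZero; prime⇒nonTrivial; euclidsLemma; ¬prime[0]; ¬prime[1])
open import Data.Nat.Primality.Factorisation using (factorise)
open import Data.Nat.Properties
import Data.Nat.Tactic.RingSolver as ℕ-Solver
open import Data.Product using (∃; ∃₂; _,_)
open import Data.Sum using ([_,_]′; inj₁; inj₂)
open import Function using (_∘_; flip; mk⇔; Equivalence)
open import Induction.WellFounded using (Acc; acc)
open import Relation.Binary.PropositionalEquality
open import Relation.Nullary using (Dec; yes; no; does; contradiction)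
open import Relation.Nullary.Decidable using (T?; does-⇔; dec-true; dec-false; toSum)
open import Relation.Unary using (Decidable)

private variable
  d k m n p q t x α β : ℕ
  c : ℕ → ℤ

-- Finite sums and counts

∑ : ℕ → (ℕ → ℤ) → ℤ
∑ zero    f = 0ℤ
∑ (suc n) f = f 0 ℤ.+ ∑ n (f ∘ suc)

sumℤ-applyUpTo : ∀ f n → sumℤ (applyUpTo f n) ≡ ∑ n f
sumℤ-applyUpTo f zero    = refl
sumℤ-applyUpTo f (suc n) = cong (ℤ._+_ (f 0)) (sumℤ-applyUpTo (f ∘ suc) n)

∑-cong : ∀ n {f g} → f ≗ g → ∑ n f ≡ ∑ n g
∑-cong zero    f≗g = refl
∑-cong (suc n) f≗g = cong₂ ℤ._+_ (f≗g 0) (∑-cong n (f≗g ∘ suc))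

∑-distrib-+ : ∀ n f g → ∑ n (λ i → f i ℤ.+ g i) ≡ ∑ n f ℤ.+ ∑ n g
∑-distrib-+ zero    f g = refl
∑-distrib-+ (suc n) f g =
  trans (cong (ℤ._+_ (f 0 ℤ.+ g 0)) (∑-distrib-+ n (f ∘ suc) (g ∘ suc)))
        (interchange (f 0) (g 0) (∑ n (f ∘ suc)) (∑ n (g ∘ suc)))

∑-+ : ∀ m n f → ∑ (m + n) f ≡ ∑ m f ℤ.+ ∑ n (λ i → f (m + i))
∑-+ zero    n f = sym (ℤP.+-identityˡ _)
∑-+ (suc m) n f =
  trans (cong (ℤ._+_ (f 0)) (∑-+ m n (f ∘ suc))) (sym (ℤP.+-assoc (f 0) (∑ m (f ∘ suc)) _))

∑-zero : ∀ n {f} → (∀ i → i < n → f i ≡ 0ℤ) → ∑ n f ≡ 0ℤ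
∑-zero zero    _   = refl
∑-zero (suc n) f≡0 = cong₂ ℤ._+_ (f≡0 0 z<s) (∑-zero n (λ i i<n → f≡0 (suc i) (s<s i<n)))

∑-extend : ∀ f → m ≤ n → (∀ i → m ≤ i → f i ≡ 0ℤ) → ∑ n f ≡ ∑ m f
∑-extend {n = n} f z≤n       f≡0 = ∑-zero n (λ i _ → f≡0 i z≤n)
∑-extend         f (s≤s m≤n) f≡0 =
  cong (ℤ._+_ (f 0)) (∑-extend (f ∘ suc) m≤n (λ i m≤i → f≡0 (suc i) (s≤s m≤i)))

∑-multiples : ∀ m {p} .{{_ : NonZero p}} f → (∀ i → ¬ p ∣ i → f i ≡ 0ℤ) →
              ∑ (m * p) f ≡ ∑ m (λ j → f (j * p))
∑-multiples zero    f _ = refl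
∑-multiples (suc m) {p@(suc p-1)} f f≡0 = begin
  ∑ (p + m * p) f                                      ≡⟨ ∑-+ p (m * p) f ⟩
  (f 0 ℤ.+ ∑ p-1 (f ∘ suc)) ℤ.+ ∑ (m * p) (f ∘ _+_ p)
    ≡⟨ cong₂ (λ x y → (f 0 ℤ.+ x) ℤ.+ y) (∑-zero p-1 inside) (∑-multiples m (f ∘ _+_ p) shifted) ⟩
  (f 0 ℤ.+ 0ℤ) ℤ.+ ∑ m (λ j → f (p + j * p))
    ≡⟨ cong (ℤ._+ ∑ m (λ j → f (p + j * p))) (ℤP.+-identityʳ (f 0)) ⟩
  f 0 ℤ.+ ∑ m (λ j → f (p + j * p))                    ∎
  where
  open ≡-Reasoning
  inside : ∀ i → i < p-1 → f (suc i) ≡ 0ℤ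
  inside i i<p-1 = f≡0 (suc i) (<⇒≱ (s<s i<p-1) ∘ ∣⇒≤)
  shifted : ∀ i → ¬ p ∣ i → f (p + i) ≡ 0ℤ
  shifted i p∤i = f≡0 (p + i) (p∤i ∘ flip ∣m+n∣m⇒∣n ∣-refl)

∣ℤ-0 : ∀ {d x} → x ≡ 0ℤ → d ∣ℤ x
∣ℤ-0 refl = ℤ∣.∣ᵤ⇒∣ (_ ∣0)

∣-∑ : ∀ n {d f} → (∀ i → d ∣ℤ f i) → d ∣ℤ ∑ n f
∣-∑ zero    _   = ∣ℤ-0 refl
∣-∑ (suc n) d∣f = ℤ∣.∣m∣n⇒∣m+n (d∣f 0) (∣-∑ n (d∣f ∘ suc))

count : ℕ → (ℕ → Bool) → ℕ
count zero    f = 0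
count (suc n) f = if f 0 then suc (count n (f ∘ suc)) else count n (f ∘ suc)

count-cong : ∀ n {f g} → f ≗ g → count n f ≡ count n g
count-cong zero    f≗g = refl
count-cong (suc n) f≗g =
  cong₂ (λ b k → if b then suc k else k) (f≗g 0) (count-cong n (f≗g ∘ suc))

count-false : ∀ n {f} → (∀ i → f i ≡ false) → count n f ≡ 0
count-false zero    f≡false = refl
count-false (suc n) {f} f≡false rewrite f≡false 0 = count-false n (f≡false ∘ suc)

count-extend : ∀ f → m ≤ n → (∀ i → m ≤ i → f i ≡ false) → count n f ≡ count m f
count-extend {n = n} f z≤n       f≡false = count-false n (λ i → f≡false i z≤n)
count-extend         f (s≤s m≤n) f≡false =
  cong (λ k → if f 0 then suc k else k)
       (count-extend (f ∘ suc) m≤n (λ i m≤i → f≡false (suc i) (s≤s m≤i)))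

count-insert : ∀ f g → x < n → f x ≡ true → g x ≡ false → (∀ i → i ≢ x → f i ≡ g i) →
               count n f ≡ suc (count n g)
count-insert {zero}  {suc n} f g _ fx gx f≡g rewrite fx | gx =
  cong suc (count-cong n (λ i → f≡g (suc i) λ ()))
count-insert {suc x} {suc n} f g (s<s x<n) fx gx f≡g
  rewrite f≡g 0 (λ ())
        | count-insert (f ∘ suc) (g ∘ suc) x<n fx gx (λ i i≢x → f≡g (suc i) (i≢x ∘ suc-injective))
  with g 0
... | true  = refl
... | false = refl

length-filter-filter : ∀ {P Q : ℕ → Set} (P? : Decidable P) (Q? : Decidable Q) g n →
                       length (filter Q? (filter P? (applyUpTo g n)))
                         ≡ count n (λ i → does (P? (g i)) ∧ does (Q? (g i)))
length-filter-filter P? Q? g zero = refl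
length-filter-filter P? Q? g (suc n) with does (P? (g 0))
... | false = length-filter-filter P? Q? (g ∘ suc) n
... | true with does (Q? (g 0))
...   | true  = cong suc (length-filter-filter P? Q? (g ∘ suc) n)
...   | false = length-filter-filter P? Q? (g ∘ suc) n

-- Divisibility by prime powers

n<m^n : 1 < m → ∀ n → n < m ^ n
n<m^n     1<m zero    = z<s
n<m^n {m} 1<m (suc n) = begin-strict
  suc n     ≤⟨ n<m^n 1<m n ⟩
  m ^ n     <⟨ m<m*n (m ^ n) m 1<m ⟩
  m ^ n * m ≡⟨ *-comm (m ^ n) m ⟩
  m * m ^ n ∎
  where
  open ≤-Reasoning
  instance
    m≢0 : NonZero m
    m≢0 = >-nonZero (<-trans z<s 1<m)
    m^n≢0′ : NonZero (m ^ n)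
    m^n≢0′ = m^n≢0 m n

prime>1 : Prime p → 1 < p
prime>1 {p} pp = nonTrivial⇒n>1 p {{prime⇒nonTrivial pp}}

divisor≢0 : .{{NonZero n}} → d ∣ n → NonZero d
divisor≢0 {n} d∣n = ≢-nonZero λ { refl → ≢-nonZero⁻¹ n (0∣⇒≡0 d∣n) }

prime⇒coprime : Prime p → ¬ p ∣ n → Coprime p n
prime⇒coprime pp p∤n (d∣p , d∣n) with prime⇒irreducible pp d∣p
... | inj₁ d≡1 = d≡1
... | inj₂ refl = contradiction d∣n p∤n

prime^∣m*n⇒∣n : ∀ α → Prime p → ¬ p ∣ m → p ^ α ∣ m * n → p ^ α ∣ n
prime^∣m*n⇒∣n zero _ _ _ = 1∣ _
prime^∣m*n⇒∣n {p} {m} {n} (suc α) pp p∤m p^α+1∣mn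
  with euclidsLemma m n pp (∣-trans (m∣m*n (p ^ α)) p^α+1∣mn)
... | inj₁ p∣m = contradiction p∣m p∤m
... | inj₂ (divides k refl) = subst (_∣ k * p) (*-comm (p ^ α) p) (*-monoˡ-∣ p p^α∣k)
  where
  instance
    p≢0 : NonZero p
    p≢0 = prime⇒nonZero pp
  p^α∣k : p ^ α ∣ k
  p^α∣k = prime^∣m*n⇒∣n α pp p∤m (*-cancelˡ-∣ p (subst (p ^ suc α ∣_) (shuffle m k p) p^α+1∣mn))
    where
    shuffle : ∀ m k p → m * (k * p) ≡ p * (m * k)
    shuffle = ℕ-Solver.solve-∀

prime^*∣ : Prime p → ¬ p ∣ k → p ^ α ∣ t → k ∣ t → p ^ α * k ∣ t
prime^*∣ {p} {k} {α} pp p∤k p^α∣t (divides s refl) =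
  *-monoˡ-∣ k (prime^∣m*n⇒∣n α pp p∤k (subst (p ^ α ∣_) (*-comm s k) p^α∣t))

primeDivisor : ∀ n → .{{NonTrivial n}} → ∃ λ p → Prime p × p ∣ n
primeDivisor n@(2+ _) with factorise n
... | record { factors = p ∷ ps ; isFactorisation = n≡p*ps ; factorsPrime = pp ∷ _ } =
  p , pp , divides (product ps) (trans n≡p*ps (*-comm p (product ps)))

factorOut : Prime p → ∀ n → .{{NonZero n}} → ∃₂ λ α k → n ≡ p ^ α * k × ¬ p ∣ k
factorOut {p} pp n = go (<-wellFounded n)
  where
  instance
    p-nonTrivial : NonTrivial p
    p-nonTrivial = prime⇒nonTrivial pp
  go : ∀ {n} → Acc _<_ n → .{{NonZero n}} → ∃₂ λ α k → n ≡ p ^ α * k × ¬ p ∣ k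
  go {n} (acc rec) with p ∣? n
  ... | no p∤n = 0 , n , sym (*-identityˡ n) , p∤n
  ... | yes p∣n@(divides q n≡q*p) with go (rec (quotient-< p∣n)) {{quotient≢0 p∣n}}
  ...   | α , k , q≡p^α*k , p∤k = suc α , k , n≡ , p∤k
    where
    n≡ : n ≡ p * p ^ α * k
    n≡ = trans n≡q*p (trans (cong (_* p) q≡p^α*k) (trans (*-comm _ p) (sym (*-assoc p (p ^ α) k))))

∣-fromPrimePowers : ∀ n → .{{NonZero n}} → (∀ p α → Prime p → p ^ α ∣ n → p ^ α ∣ t) → n ∣ t
∣-fromPrimePowers {t} n = go (<-wellFounded n)
  where
  go : ∀ {n} → Acc _<_ n → .{{NonZero n}} → (∀ p α → Prime p → p ^ α ∣ n → p ^ α ∣ t) → n ∣ t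
  go {1}        _         _            = 1∣ t
  go {n@(2+ _)} (acc rec) primePowers∣t with primeDivisor n
  ... | p , pp , p∣n with factorOut pp n
  ... | zero  , k , n≡k       , p∤k = contradiction (subst (p ∣_) (trans n≡k (*-identityˡ k)) p∣n) p∤k
  ... | suc α , k , n≡p^α+1*k , p∤k =
    subst (_∣ t) (sym n≡p^α+1*k) (prime^*∣ {α = suc α} pp p∤k p^α+1∣t k∣t)
    where
    k∣n : k ∣ n
    k∣n = subst (k ∣_) (sym n≡p^α+1*k) (n∣m*n (p ^ suc α))
    instance
      k≢0 : NonZero k
      k≢0 = divisor≢0 k∣n
    k<n : k < n
    k<n = begin-strict
      k               <⟨ m<m*n k (p ^ suc α) (<-≤-trans (prime>1 pp) (m≤m*n p (p ^ α) {{p^α≢0}})) ⟩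
      k * p ^ suc α   ≡⟨ *-comm k (p ^ suc α) ⟩
      p ^ suc α * k   ≡⟨ n≡p^α+1*k ⟨
      n               ∎
      where
      open ≤-Reasoning
      p^α≢0 : NonZero (p ^ α)
      p^α≢0 = m^n≢0 p α {{prime⇒nonZero pp}}
    p^α+1∣t : p ^ suc α ∣ t
    p^α+1∣t = primePowers∣t p (suc α) pp (subst (p ^ suc α ∣_) (sym n≡p^α+1*k) (m∣m*n k))
    k∣t : k ∣ t
    k∣t = go (rec k<n) (λ q β qq q^β∣k → primePowers∣t q β qq (∣-trans q^β∣k k∣n))

-- The Möbius function

allᵇ⇒All : ∀ {f} xs → T (allᵇ f xs) → All (T ∘ f) xs
allᵇ⇒All []       _ = []
allᵇ⇒All (x ∷ xs) t with Equivalence.to T-∧ t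
... | tx , txs = tx ∷ allᵇ⇒All xs txs

All⇒allᵇ : ∀ {f xs} → All (T ∘ f) xs → T (allᵇ f xs)
All⇒allᵇ []         = _
All⇒allᵇ (px ∷ pxs) = Equivalence.from T-∧ (px , All⇒allᵇ pxs)

SquareFree : ℕ → Set
SquareFree n = ∀ d → 1 < d → ¬ d * d ∣ n

-- The hypothesis n ≢ 0 is needed: squarefreeᵇ 0 is true.
squarefreeᵇ-sound : .{{NonZero n}} → T (squarefreeᵇ n) → SquareFree n
squarefreeᵇ-sound {suc m} t d@(suc (suc i)) (s≤s (s≤s _)) dd∣n =
  subst (T ∘ not) (dec-true (d * d ∣? suc m) dd∣n) (applyUpTo⁻ _ m (allᵇ⇒All _ t) i<m)
  where
  i<m : i < m
  i<m = ≤-pred (≤-trans (m≤m*n d d) (∣⇒≤ dd∣n))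

squarefreeᵇ-complete : SquareFree n → T (squarefreeᵇ n)
squarefreeᵇ-complete {zero}  sf = _
squarefreeᵇ-complete {suc m} sf = All⇒allᵇ (applyUpTo⁺₁ _ m λ {i} _ →
  subst (T ∘ not) (sym (dec-false ((2 + i) * (2 + i) ∣? suc m) (sf (2 + i) (s≤s (s≤s z≤n))))) _)

squareFree-*-prime : Prime p → ¬ p ∣ q → SquareFree q → SquareFree (q * p)
squareFree-*-prime {p} {q} pp p∤q sf d 1<d dd∣qp with p ∣? d
... | no p∤d =
  sf d 1<d (coprime-divisor (Coprime.sym (prime⇒coprime pp p∤dd)) (subst (d * d ∣_) (*-comm q p) dd∣qp))
  where
  p∤dd : ¬ p ∣ d * d
  p∤dd = [ p∤d , p∤d ]′ ∘ euclidsLemma d d pp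
... | yes (divides e refl) =
  p∤q (∣-trans (n∣m*n (e * e)) (*-cancelʳ-∣ p {{prime⇒nonZero pp}} (subst (_∣ q * p) (square e p) dd∣qp)))
  where
  square : ∀ e p → e * p * (e * p) ≡ e * e * p * p
  square = ℕ-Solver.solve-∀

squarefreeᵇ-*-prime : .{{NonZero q}} → Prime p → ¬ p ∣ q → squarefreeᵇ (q * p) ≡ squarefreeᵇ q
squarefreeᵇ-*-prime {q} {p} pp p∤q = does-⇔ (mk⇔ sf⇒ sf⇐) (T? _) (T? _)   -- does (T? b) is b
  where
  instance
    p≢0 : NonZero p
    p≢0 = prime⇒nonZero pp
  sf⇒ : T (squarefreeᵇ (q * p)) → T (squarefreeᵇ q)
  sf⇒ t = squarefreeᵇ-complete {q} λ d 1<d dd∣q →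
            squarefreeᵇ-sound {q * p} {{m*n≢0 q p}} t d 1<d (∣m⇒∣m*n p dd∣q)
  sf⇐ : T (squarefreeᵇ q) → T (squarefreeᵇ (q * p))
  sf⇐ t = squarefreeᵇ-complete (squareFree-*-prime pp p∤q (squarefreeᵇ-sound t))

numPrimeDivisors-count : ∀ n →
                         numPrimeDivisors n ≡ count n (λ i → does (suc i ∣? n) ∧ does (prime? (suc i)))
numPrimeDivisors-count n = length-filter-filter (_∣? n) prime? suc n

numPrimeDivisors-*-prime : .{{NonZero q}} → Prime p → ¬ p ∣ q →
                           numPrimeDivisors (q * p) ≡ suc (numPrimeDivisors q)
numPrimeDivisors-*-prime {q} {p@(suc p-1)} pp p∤q = begin
  numPrimeDivisors (q * p)                 ≡⟨ numPrimeDivisors-count (q * p) ⟩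
  count (q * p) (isPrimeDivisorᵇ (q * p)) ≡⟨ count-insert _ _ (m≤n*m p q) p-counted p-uncounted others ⟩
  suc (count (q * p) (isPrimeDivisorᵇ q)) ≡⟨ cong suc (count-extend _ (m≤m*n q p) beyond-q) ⟩
  suc (count q (isPrimeDivisorᵇ q))       ≡⟨ cong suc (numPrimeDivisors-count q) ⟨
  suc (numPrimeDivisors q)                 ∎
  where
  open ≡-Reasoning
  isPrimeDivisorᵇ : ℕ → ℕ → Bool
  isPrimeDivisorᵇ n i = does (suc i ∣? n) ∧ does (prime? (suc i))
  p-counted : isPrimeDivisorᵇ (q * p) p-1 ≡ true
  p-counted rewrite dec-true (p ∣? q * p) (n∣m*n q) | dec-true (prime? p) pp = refl
  p-uncounted : isPrimeDivisorᵇ q p-1 ≡ false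
  p-uncounted rewrite dec-false (p ∣? q) p∤q = refl
  beyond-q : ∀ i → q ≤ i → isPrimeDivisorᵇ q i ≡ false
  beyond-q i q≤i rewrite dec-false (suc i ∣? q) (<⇒≱ (s≤s q≤i) ∘ ∣⇒≤) = refl
  others : ∀ i → i ≢ p-1 → isPrimeDivisorᵇ (q * p) i ≡ isPrimeDivisorᵇ q i
  others i i≢p-1 with prime? (suc i)
  ... | no _        = trans (∧-zeroʳ _) (sym (∧-zeroʳ _))
  ... | yes r-prime =
    cong (_∧ true) (does-⇔ (mk⇔ r∣qp⇒r∣q (∣m⇒∣m*n p)) (suc i ∣? q * p) (suc i ∣? q))
    where
    r∣qp⇒r∣q : suc i ∣ q * p → suc i ∣ q
    r∣qp⇒r∣q r∣qp with euclidsLemma q p r-prime r∣qp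
    ... | inj₁ r∣q = r∣q
    ... | inj₂ r∣p with prime⇒irreducible pp r∣p
    ...   | inj₁ r≡1 = contradiction (subst Prime r≡1 r-prime) ¬prime[1]
    ...   | inj₂ r≡p = contradiction (suc-injective r≡p) i≢p-1

μ-*-prime : .{{NonZero q}} → Prime p → ¬ p ∣ q → μ (q * p) ≡ ℤ.- μ q
μ-*-prime {q} {p} pp p∤q
  rewrite squarefreeᵇ-*-prime pp p∤q | numPrimeDivisors-*-prime pp p∤q
  with squarefreeᵇ q
... | true  = refl
... | false = refl

μ-non-squarefree : .{{NonZero n}} → 1 < d → d * d ∣ n → μ n ≡ 0ℤ
μ-non-squarefree {n} 1<d dd∣n with squarefreeᵇ n in sf
... | true  = contradiction dd∣n (squarefreeᵇ-sound (subst T (sym sf) _) _ 1<d)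
... | false = refl

-- Möbius sums of sequences with the Dold congruences

DoldCongruences : (ℕ → ℤ) → Set
DoldCongruences c = ∀ p α x → Prime p → p ^ α ∣ x → + (p ^ suc α) ∣ℤ c (x * p) ℤ.- c x

if-yes : ∀ {A B : Set} (a? : Dec A) {x y : B} → A → (if does a? then x else y) ≡ x
if-yes a? a = cong (if_then _ else _) (dec-true a? a)

if-no : ∀ {A B : Set} (a? : Dec A) {x y : B} → ¬ A → (if does a? then x else y) ≡ y
if-no a? ¬a = cong (if_then _ else _) (dec-false a? ¬a)

divisorTerm : (ℕ → ℤ) → ℕ → ℕ → ℤ
divisorTerm c n d with d ∣? n
... | yes d∣n = μ (quotient d∣n) ℤ.* c d
... | no  _   = 0ℤ

divisorTerm-∣ : ∀ c .{{_ : NonZero d}} (d∣n : d ∣ n) → divisorTerm c n d ≡ μ (quotient d∣n) ℤ.* c d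
divisorTerm-∣ {d} {n} c d∣n with d ∣? n
... | yes d∣n′ = cong (λ r → μ r ℤ.* c d)
  (*-cancelʳ-≡ (quotient d∣n′) (quotient d∣n) d
                (trans (sym (m∣n⇒n≡quotient*m d∣n′)) (m∣n⇒n≡quotient*m d∣n)))
... | no  d∤n   = contradiction d∣n d∤n

divisorTerm-∤ : ∀ c → ¬ d ∣ n → divisorTerm c n d ≡ 0ℤ
divisorTerm-∤ {d} {n} c d∤n with d ∣? n
... | yes d∣n = contradiction d∣n d∤n
... | no  _   = refl

mobiusSum-divisorTerm : .{{NonZero n}} → mobiusSum c n ≡ ∑ (suc n) (divisorTerm c n)
mobiusSum-divisorTerm {n} {c} = begin
  mobiusSum c n                             ≡⟨ cong sumℤ (map-upTo summand n) ⟩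
  sumℤ (applyUpTo summand n)                ≡⟨ sumℤ-applyUpTo summand n ⟩
  ∑ n summand                               ≡⟨ ∑-cong n summand≡divisorTerm ⟩
  ∑ n (divisorTerm c n ∘ suc)               ≡⟨ ℤP.+-identityˡ _ ⟨
  0ℤ ℤ.+ ∑ n (divisorTerm c n ∘ suc)
    ≡⟨ cong (ℤ._+ ∑ n (divisorTerm c n ∘ suc)) (divisorTerm-∤ c 0∤n) ⟨
  ∑ (suc n) (divisorTerm c n)               ∎
  where
  open ≡-Reasoning
  summand : ℕ → ℤ
  summand k = if does (suc k ∣? n) then μ (n / suc k) ℤ.* c (suc k) else + 0
  summand≡divisorTerm : ∀ k → summand k ≡ divisorTerm c n (suc k)
  summand≡divisorTerm k = [ k+1∣n , k+1∤n ]′ (toSum (suc k ∣? n))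
    where
    k+1∣n : suc k ∣ n → summand k ≡ divisorTerm c n (suc k)
    k+1∣n k+1∣n = begin
      summand k                         ≡⟨ if-yes (suc k ∣? n) k+1∣n ⟩
      μ (n / suc k) ℤ.* c (suc k)       ≡⟨ cong (λ r → μ r ℤ.* c (suc k)) (n/m≡quotient k+1∣n) ⟩
      μ (quotient k+1∣n) ℤ.* c (suc k)  ≡⟨ divisorTerm-∣ c k+1∣n ⟨
      divisorTerm c n (suc k)           ∎
    k+1∤n : ¬ suc k ∣ n → summand k ≡ divisorTerm c n (suc k)
    k+1∤n k+1∤n = trans (if-no (suc k ∣? n) k+1∤n) (sym (divisorTerm-∤ c k+1∤n))
  0∤n : ¬ 0 ∣ n
  0∤n = ≢-nonZero⁻¹ n ∘ 0∣⇒≡0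

module Pairing (c : ℕ → ℤ) {p n : ℕ} (pp : Prime p) .{{_ : NonZero n}} (p∣n : p ∣ n) where

  instance
    p≢0 : NonZero p
    p≢0 = prime⇒nonZero pp

  term : ℕ → ℤ
  term = divisorTerm c n

  -- For d ∣ n, d p ∣ n iff p ∣ n/d: low keeps the terms with p ∣ n/d, high the others.
  low high : ℕ → ℤ
  low  d = if does (d * p ∣? n) then term d else 0ℤ
  high d = if does (d * p ∣? n) then 0ℤ else term d

  term≡low+high : ∀ d → term d ≡ low d ℤ.+ high d
  term≡low+high d = split (does (d * p ∣? n))
    where
    split : ∀ b → term d ≡ (if b then term d else 0ℤ) ℤ.+ (if b then 0ℤ else term d)
    split true  = sym (ℤP.+-identityʳ (term d))
    split false = sym (ℤP.+-identityˡ (term d))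

  high-∤n : ¬ d ∣ n → high d ≡ 0ℤ
  high-∤n {d} d∤n = [ if-yes (d * p ∣? n) , high≡0 ]′ (toSum (d * p ∣? n))
    where
    high≡0 : ¬ d * p ∣ n → high d ≡ 0ℤ
    high≡0 dp∤n = trans (if-no (d * p ∣? n) dp∤n) (divisorTerm-∤ c d∤n)

  high-multiples : ∀ d → ¬ p ∣ d → high d ≡ 0ℤ
  high-multiples d p∤d = [ if-yes (d * p ∣? n) ∘ dp∣n , high-∤n ]′ (toSum (d ∣? n))
    where
    dp∣n : d ∣ n → d * p ∣ n
    dp∣n (divides q n≡q*d) with euclidsLemma q d pp (subst (p ∣_) n≡q*d p∣n)
    ... | inj₁ (divides r refl) = divides r (trans n≡q*d (trans (*-assoc r p d) (cong (r *_) (*-comm p d))))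
    ... | inj₂ p∣d              = contradiction p∣d p∤d

  mobiusSum≡∑pairs : mobiusSum c n ≡ ∑ (suc n) (λ j → low j ℤ.+ high (j * p))
  mobiusSum≡∑pairs = begin
    mobiusSum c n                         ≡⟨ mobiusSum-divisorTerm ⟩
    ∑ N term                              ≡⟨ ∑-cong N term≡low+high ⟩
    ∑ N (λ i → low i ℤ.+ high i)          ≡⟨ ∑-distrib-+ N low high ⟩
    ∑ N low ℤ.+ ∑ N high                  ≡⟨ cong (ℤ._+_ (∑ N low)) (∑-extend high (m≤m*n N p) high-beyond) ⟨
    ∑ N low ℤ.+ ∑ (N * p) high            ≡⟨ cong (ℤ._+_ (∑ N low)) (∑-multiples N high high-multiples) ⟩
    ∑ N low ℤ.+ ∑ N (λ j → high (j * p))  ≡⟨ ∑-distrib-+ N low (λ j → high (j * p)) ⟨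
    ∑ N (λ j → low j ℤ.+ high (j * p))    ∎
    where
    open ≡-Reasoning
    N : ℕ
    N = suc n
    high-beyond : ∀ i → N ≤ i → high i ≡ 0ℤ
    high-beyond i n<i = high-∤n (<⇒≱ n<i ∘ ∣⇒≤)

  pair-∤ : ∀ j → ¬ j * p ∣ n → low j ℤ.+ high (j * p) ≡ 0ℤ
  pair-∤ j jp∤n = cong₂ ℤ._+_ (if-no (j * p ∣? n) jp∤n) (high-∤n jp∤n)

  module _ (q j : ℕ) (n≡q*jp : n ≡ q * (j * p)) where

    private
      jp∣n : j * p ∣ n
      jp∣n = divides q n≡q*jp
      j∣n : j ∣ n
      j∣n = divides (q * p) (trans n≡q*jp (reassoc q j p))
        where
        reassoc : ∀ q j p → q * (j * p) ≡ q * p * j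
        reassoc = ℕ-Solver.solve-∀
      instance
        j≢0 : NonZero j
        j≢0 = divisor≢0 j∣n
        jp≢0 : NonZero (j * p)
        jp≢0 = divisor≢0 jp∣n
        q≢0 : NonZero q
        q≢0 = quotient≢0 jp∣n

      low-j : low j ≡ μ (q * p) ℤ.* c j
      low-j = trans (if-yes (j * p ∣? n) jp∣n) (divisorTerm-∣ c j∣n)

    pair-p∣q : p ∣ q → low j ℤ.+ high (j * p) ≡ 0ℤ
    pair-p∣q (divides r refl) = cong₂ ℤ._+_ low-j≡0 (if-yes (j * p * p ∣? n) jpp∣n)
      where
      jpp∣n : j * p * p ∣ n
      jpp∣n = divides r (trans n≡q*jp (reassoc r p j))
        where
        reassoc : ∀ r p j → r * p * (j * p) ≡ r * (j * p * p)
        reassoc = ℕ-Solver.solve-∀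
      low-j≡0 : low j ≡ 0ℤ
      low-j≡0 = begin
        low j                    ≡⟨ low-j ⟩
        μ (r * p * p) ℤ.* c j    ≡⟨ cong (ℤ._* c j) μ≡0 ⟩
        0ℤ ℤ.* c j               ≡⟨ ℤP.*-zeroˡ (c j) ⟩
        0ℤ                       ∎
        where
        open ≡-Reasoning
        μ≡0 : μ (r * p * p) ≡ 0ℤ
        μ≡0 = μ-non-squarefree {{m*n≢0 (r * p) p}} (prime>1 pp) (divides r (*-assoc r p p))

    pair-p∤q : ¬ p ∣ q → low j ℤ.+ high (j * p) ≡ μ q ℤ.* (c (j * p) ℤ.- c j)
    pair-p∤q p∤q = begin
      low j ℤ.+ high (j * p)                 ≡⟨ cong₂ ℤ._+_ low-j (if-no (j * p * p ∣? n) jpp∤n) ⟩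
      μ (q * p) ℤ.* c j ℤ.+ term (j * p)
        ≡⟨ cong₂ (λ x y → x ℤ.* c j ℤ.+ y) (μ-*-prime pp p∤q) (divisorTerm-∣ c jp∣n) ⟩
      ℤ.- μ q ℤ.* c j ℤ.+ μ q ℤ.* c (j * p)  ≡⟨ collect (μ q) (c j) (c (j * p)) ⟩
      μ q ℤ.* (c (j * p) ℤ.- c j)            ∎
      where
      open ≡-Reasoning
      jpp∤n : ¬ j * p * p ∣ n
      jpp∤n (divides r n≡r*jpp) =
        p∤q (divides r (*-cancelʳ-≡ q (r * p) (j * p) (trans (sym n≡q*jp) (trans n≡r*jpp (reassoc r j p)))))
        where
        reassoc : ∀ r j p → r * (j * p * p) ≡ r * p * (j * p)
        reassoc = ℕ-Solver.solve-∀
      collect : ∀ m x y → ℤ.- m ℤ.* x ℤ.+ m ℤ.* y ≡ m ℤ.* (y ℤ.- x)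
      collect = ℤ-Solver.solve-∀

prime^∣mobiusSum : ∀ c α → DoldCongruences c → Prime p → .{{NonZero n}} → p ^ α ∣ n →
                   + (p ^ α) ∣ℤ mobiusSum c n
prime^∣mobiusSum c zero _ _ _ = ℤ∣.∣ᵤ⇒∣ (1∣ _)
prime^∣mobiusSum {p} {n} c (suc β) dold pp p^β+1∣n =
  subst (+ (p ^ suc β) ∣ℤ_) (sym mobiusSum≡∑pairs) (∣-∑ (suc n) pair)
  where
  open Pairing c pp (∣-trans (m∣m*n (p ^ β)) p^β+1∣n)

  matched : ∀ q j → n ≡ q * (j * p) → + (p ^ suc β) ∣ℤ low j ℤ.+ high (j * p)
  matched q j n≡q*jp = [ ∣ℤ-0 ∘ pair-p∣q q j n≡q*jp , p∤q-case ]′ (toSum (p ∣? q))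
    where
    p∤q-case : ¬ p ∣ q → + (p ^ suc β) ∣ℤ low j ℤ.+ high (j * p)
    p∤q-case p∤q =
      subst (+ (p ^ suc β) ∣ℤ_) (sym (pair-p∤q q j n≡q*jp p∤q)) (ℤ∣.∣n⇒∣m*n (μ q) (dold p β j pp p^β∣j))
      where
      p^β∣j : p ^ β ∣ j
      p^β∣j = *-cancelˡ-∣ p {{prime⇒nonZero pp}} (subst (p ^ suc β ∣_) (*-comm j p)
                (prime^∣m*n⇒∣n (suc β) pp p∤q (subst (p ^ suc β ∣_) n≡q*jp p^β+1∣n)))

  pair : ∀ j → + (p ^ suc β) ∣ℤ low j ℤ.+ high (j * p)
  pair j = [ (λ { (divides q n≡q*jp) → matched q j n≡q*jp }) , ∣ℤ-0 ∘ pair-∤ j ]′ (toSum (j * p ∣? n))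

dold⇒preRealizable : ∀ c → DoldCongruences c → PreRealizable c
dold⇒preRealizable c dold n n≥1 =
  ∣-fromPrimePowers n (λ p α pp p^α∣n → ℤ∣.∣⇒∣ᵤ (prime^∣mobiusSum c α dold pp p^α∣n))
  where
  instance
    n≢0 : NonZero n
    n≢0 = >-nonZero n≥1

-- Kummer congruences

kummerSum-1 : ∀ a m w → kummerSum a 1 m w ≡ a m ℤ.- a (m + w)
kummerSum-1 a m w rewrite +-identityʳ m | +-identityʳ w = normalise (a m) (a (m + w))
  where
  normalise : ∀ x y → + 1 ℤ.* (+ 1 ℤ.* x) ℤ.+ (ℤ.- + 1 ℤ.* (+ 1 ℤ.* y) ℤ.+ 0ℤ) ≡ x ℤ.- y
  normalise = ℤ-Solver.solve-∀

kummer⇒dold : ∀ a → KummerCongruences a → ∀ b → DoldCongruences (λ x → a (b + x))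
kummer⇒dold a K b zero        α x       pp _     = contradiction pp ¬prime[0]
kummer⇒dold a K b p           α zero    pp _     = ∣ℤ-0 (ℤP.+-inverseʳ (a (b + 0)))
kummer⇒dold a K b p@(suc p-1) α x@(suc _) pp p^α∣x =
  subst (+ (p ^ suc α) ∣ℤ_) (swap (a (b + x)) (a (b + x * p))) (ℤ∣.∣m⇒∣-m (ℤ∣.∣ᵤ⇒∣ kummer))
  where
  kummer : + (p ^ suc α) ℤD.∣ (a (b + x) ℤ.- a (b + x * p))
  kummer = subst₂ (λ e y → + (p ^ e) ℤD.∣ y) exponent
             (trans (kummerSum-1 a (b + x) (x * p-1)) (cong (λ i → a (b + x) ℤ.- a i) index))
             (K p pp (suc α) 1 (b + x) (x * p-1) (s≤s z≤n) (s≤s z≤n) (*-monoˡ-∣ p-1 p^α∣x))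
    where
    exponent : (b + x) ⊓ (1 * suc α) ≡ suc α
    exponent = trans (cong ((b + x) ⊓_) (*-identityˡ (suc α)))
                     (m≥n⇒m⊓n≡n (<-≤-trans (n<m^n (prime>1 pp) α) (≤-trans (∣⇒≤ p^α∣x) (m≤n+m x b))))
    index : b + x + x * p-1 ≡ b + x * p
    index = distrib b x p-1
      where
      distrib : ∀ b x p-1 → b + x + x * p-1 ≡ b + x * suc p-1
      distrib = ℕ-Solver.solve-∀
  swap : ∀ u v → ℤ.- (u ℤ.- v) ≡ v ℤ.- u
  swap = ℤ-Solver.solve-∀

mainTheorem4 : (a : ℕ → ℤ) → KummerCongruences a →
    (∀ (b n α p : ℕ) → b ≥ 1 → n ≥ 1 → α ≥ 1 → Prime p → ¬ (p ∣ n) →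
      (+ (p ^ α)) ℤD.∣ (a (b + n * p ^ α) ℤ.- a (b + n * p ^ (α ∸ 1))))
    × (∀ (b : ℕ) → b ≥ 1 → PreRealizable (λ n → a (b + n)))
mainTheorem4 a K =
  (λ { b n (suc α) p _ _ _ pp _ →
         subst (λ i → + (p ^ suc α) ℤD.∣ (a (b + i) ℤ.- a (b + n * p ^ α)))
               (trans (*-assoc n (p ^ α) p) (cong (n *_) (*-comm (p ^ α) p)))
               (ℤ∣.∣⇒∣ᵤ (kummer⇒dold a K b p α (n * p ^ α) pp (n∣m*n n))) }) ,
  (λ b _ → dold⇒preRealizable (λ x → a (b + x)) (kummer⇒dold a K b))
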